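{- Let $n\ge 2$, let $H_n^4$ be any graph in $\mathscr{H}_n^4$, and let $m$ be an integer with $1\le m\le 2^n$. Then $ex_m(H_n^4)\le f(m)$, where, writing $m=\sum_{i=0}^{s}2^{t_i}$ with $t_0>t_1>\cdots>t_s\ge 0$, $p=\lfloor m/4\rfloor$ and $q=m-4p$, $$f(m)=\begin{cases}\sum_{i=0}^{s}t_i2^{t_i}+\sum_{i=0}^{s}2i\,2^{t_i}+4p & \text{if } 0\le q\le 2,\\ \sum_{i=0}^{s}t_i2^{t_i}+\sum_{i=0}^{s}2i\,2^{t_i}+4p+2 & \text{if } q=3.\end{cases}$$
   Context: The family $\mathscr{H}_n^4$ ($n\ge 2$) of $n$-dimensional $K_4$-hypercubes is defined recursively: $\mathscr{H}_2^4=\{K_4\}$; for $n\ge 3$, a graph belongs to $\mathscr{H}_n^4$ if and only if (up to isomorphism) it is obtained from two vertex-disjoint graphs $G_0,G_1\in\mathscr{H}_{n-1}^4$ (not necessarily isomorphic) by adding an arbitrary perfect matching between $V(G_0)$ and $V(G_1)$. For a graph $G$ and integer $m$, $ex_m(G)=\max\{2|E(G[X])| : X\subseteq V(G),\ |X|=m\}$. -}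

module Defs where

open import Data.Nat using (ℕ; zero; suc; _+_; _*_; _^_; _⊔_; _<ᵇ_; _≡ᵇ_)
open import Data.Nat.DivMod using (_/_; _%_)
open import Data.Bool using (Bool; true; false; _∧_; if_then_else_)
open import Data.Fin using (Fin; toℕ; splitAt)
open import Data.Fin.Subset using (Subset; ∣_∣)
open import Data.Vec using (Vec; []; _∷_; lookup)
open import Data.Nat.ListAction using (sum)
open import Data.List using (List; []; _∷_; map; allFin; filter; foldr; _++_; reverse)
open import Data.Sum using (inj₁; inj₂)
open import Relation.Nullary using (does)
open import Relation.Binary.PropositionalEquality using (_≡_)
open import Function.Bundles using (_↔_; Inverse)
import Data.Fin as F
import Data.Nat as N

record Graph : Set where
  field
    size : ℕ
    adj  : Fin size → Fin size → Bool
open Graph public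

record _≅_ (G H : Graph) : Set where
  field
    bij      : Fin (size G) ↔ Fin (size H)
    adj-pres : ∀ u v → adj G u v ≡ adj H (Inverse.to bij u) (Inverse.to bij v)

K4 : Graph
K4 = record { size = 4 ; adj = λ u v → if does (u F.≟ v) then false else true }

-- Disjoint union of G0 and G1 (vertices of G0 first) plus the perfect
-- matching { u , π u } given by a bijection π : V(G0) ↔ V(G1).
join : (G0 G1 : Graph) → Fin (size G0) ↔ Fin (size G1) → Graph
join G0 G1 π = record { size = size G0 + size G1 ; adj = a }
  where
  a : Fin (size G0 + size G1) → Fin (size G0 + size G1) → Bool
  a x y with splitAt (size G0) x | splitAt (size G0) y
  ... | inj₁ u | inj₁ v = adj G0 u v
  ... | inj₂ u | inj₂ v = adj G1 u v
  ... | inj₁ u | inj₂ v = does (Inverse.to π u F.≟ v)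
  ... | inj₂ u | inj₁ v = does (Inverse.to π v F.≟ u)

data ℋ : ℕ → Graph → Set where
  base : ∀ {G} → G ≅ K4 → ℋ 2 G
  step : ∀ {n G G0 G1} (π : Fin (size G0) ↔ Fin (size G1)) →
         ℋ n G0 → ℋ n G1 → G ≅ join G0 G1 π → ℋ (suc n) G

allSubsets : (k : ℕ) → List (Subset k)
allSubsets zero = [] ∷ []
allSubsets (suc k) = map (true ∷_) (allSubsets k) ++ map (false ∷_) (allSubsets k)

edgesIn : (G : Graph) → Subset (size G) → ℕ
edgesIn G X = sum (map (λ u → sum (map (λ v →
  if (toℕ u <ᵇ toℕ v) ∧ lookup X u ∧ lookup X v ∧ adj G u v then 1 else 0)
  (allFin (size G)))) (allFin (size G)))

-- ex_m(G) = max { 2 |E(G[X])| : X ⊆ V(G), |X| = m }  (0 if no such X).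
ex : ℕ → Graph → ℕ
ex m G = foldr _⊔_ 0
  (map (λ X → 2 * edgesIn G X)
       (filter (λ X → ∣ X ∣ N.≟ m) (allSubsets (size G))))

-- Exponents of the 1-bits of m, ascending, starting at position k
-- (fuel argument; fuel m suffices since m has at most m bits).
bitsAsc : ℕ → ℕ → ℕ → List ℕ
bitsAsc zero k m = []
bitsAsc (suc fuel) k m =
  if m % 2 ≡ᵇ 1 then k ∷ bitsAsc fuel (suc k) (m / 2)
                 else bitsAsc fuel (suc k) (m / 2)

exps : ℕ → List ℕ
exps m = reverse (bitsAsc m 0 m)

sumTerms : ℕ → List ℕ → ℕ
sumTerms i [] = 0
sumTerms i (t ∷ ts) = t * 2 ^ t + 2 * i * 2 ^ t + sumTerms (suc i) ts

f : ℕ → ℕ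
f m = sumTerms 0 (exps m) + 4 * (m / 4) + (if m % 4 ≡ᵇ 3 then 2 else 0)

-- When G is built from G₀, G₁ and a matching,
-- X splits into X₀ ⊆ V(G₀) and X₁ ⊆ V(G₁) and the matching adds at most min(|X₀|, |X₁|) edges,
-- so the bound passes from K4 (checked by enumeration) through the whole construction once
-- f a + f b + 2 min(a, b) ≤ f (a + b). Write f = cubeBound + (4p + 2[q = 3]). The first part, the
-- edge bound for subsets of a hypercube, satisfies cubeBound m = cubeBound ⌊m/2⌋ + cubeBound ⌈m/2⌉ + 2⌊m/2⌋,
-- from which the inequality follows by induction on the bits of a and b; the second part is
-- superadditive by reduction mod 4.

module Submission where

open import Defs
open import Data.Nat using (ℕ; _≤_; _^_)

open import Data.Bool using (Bool; true; false; if_then_else_; _∧_; T)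
open import Data.Bool.Properties using (∧-identityʳ; ∧-zeroʳ; ∧-commutativeMonoid)
open import Data.Empty using (⊥; ⊥-elim)
open import Data.Fin using (Fin; zero; suc; toℕ; _↑ˡ_; _↑ʳ_; splitAt; _≟_)
open import Data.Fin.Properties using (splitAt-↑ˡ; splitAt-↑ʳ)
open import Data.Fin.Subset using (Subset; ∣_∣)
open import Data.List using (List; []; _∷_; map; length; reverse; _∷ʳ_; filter; foldr)
import Data.List as List
open import Data.List.Properties using (unfold-reverse; length-reverse; length-map)
open import Data.Nat using (zero; suc; 2+; _+_; _*_; _<_; _⊓_; _⊔_; _<ᵇ_; _≡ᵇ_; z≤n; s≤s; nonZero)
open import Data.Nat.DivMod
  using (_/_; _%_; m*n%n≡0; m*n/n≡m; [m+kn]%n≡m%n; [m+n]%n≡m%n; +-distrib-/-∣ʳ; m/n≡1+[m∸n]/n)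
open import Data.Nat.Divisibility using (divides-refl)
open import Data.Nat.Induction using (<-rec)
open import Data.Nat.ListAction using () renaming (sum to sumᴸ)
open import Data.Nat.Properties hiding (_≟_)
open import Data.Nat.Solver using (module +-*-Solver)
open import Data.Sum using (inj₁; inj₂)
open import Data.Vec using ([]; _∷_; lookup; tabulate)
open import Data.Vec.Properties using (lookup∘tabulate)
open import Function.Base using (_∘_)
open import Function.Bundles using (_↔_; Inverse)
open import Relation.Binary.PropositionalEquality hiding (J)
open import Relation.Nullary using (does; yes; no)
open +-*-Solver
open import Algebra.Bundles using (CommutativeMonoid)
open import Algebra.Properties.CommutativeMonoid.Sum +-0-commutativeMonoid
  using (sum; sum-syntax; sum-cong-≗; sum-replicate-zero; ∑-distrib-+; ∑-comm; sum-permute)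
open import Algebra.Properties.CommutativeSemigroup (CommutativeMonoid.commutativeSemigroup ∧-commutativeMonoid)
  using () renaming (x∙yz≈y∙xz to ∧-exchange)

data BinaryView : ℕ → Set where
  even : ∀ x → BinaryView (x * 2)
  odd  : ∀ x → BinaryView (suc (x * 2))

binaryView : ∀ m → BinaryView m
binaryView zero = even 0
binaryView (suc m) with binaryView m
... | even x = odd x
... | odd x  = even (suc x)

binary-induction : (P : ℕ → Set) → P 0 → (∀ x → P x → P (x * 2)) →
                   (∀ x → P x → P (suc (x * 2))) → ∀ m → P m
binary-induction P p0 pe po = <-rec P go
  where
  go : ∀ m → (∀ {k} → k < m → P k) → P m
  go m rec with binaryView m
  ... | even zero    = p0
  ... | even (suc x) = pe (suc x) (rec (s≤s (s≤s (m≤m*n x 2))))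
  ... | odd x        = po x (rec (s≤s (m≤m*n x 2)))

m*2≤1+n⇒m≤n : ∀ {m n} → m * 2 ≤ suc n → m ≤ n
m*2≤1+n⇒m≤n {zero}  _            = z≤n
m*2≤1+n⇒m≤n {suc m} (s≤s 1+m*2≤n) = ≤-trans (s≤s (m≤m*n m 2)) 1+m*2≤n

1+m*2≤1+n⇒m≤n : ∀ {m n} → suc (m * 2) ≤ suc n → m ≤ n
1+m*2≤1+n⇒m≤n {m} (s≤s m*2≤n) = ≤-trans (m≤m*n m 2) m*2≤n

bitsAsc-even : ∀ fuel k x → bitsAsc (suc fuel) k (x * 2) ≡ bitsAsc fuel (suc k) x
bitsAsc-even fuel k x rewrite m*n%n≡0 x 2 ⦃ nonZero ⦄ | m*n/n≡m x 2 ⦃ nonZero ⦄ = refl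

bitsAsc-odd : ∀ fuel k x → bitsAsc (suc fuel) k (suc (x * 2)) ≡ k ∷ bitsAsc fuel (suc k) x
bitsAsc-odd fuel k x
  rewrite [m+kn]%n≡m%n 1 x 2 ⦃ nonZero ⦄
        | +-distrib-/-∣ʳ 1 {x * 2} {2} ⦃ nonZero ⦄ (divides-refl x)
        | m*n/n≡m x 2 ⦃ nonZero ⦄
        = refl

bitsAsc-zero : ∀ fuel k → bitsAsc fuel k 0 ≡ []
bitsAsc-zero zero       k = refl
bitsAsc-zero (suc fuel) k = bitsAsc-zero fuel (suc k)

bitsAsc-shift : ∀ fuel k m → bitsAsc fuel (suc k) m ≡ map suc (bitsAsc fuel k m)
bitsAsc-shift zero       k m = refl
bitsAsc-shift (suc fuel) k m with m % 2 ≡ᵇ 1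
... | true  = cong (suc k ∷_) (bitsAsc-shift fuel (suc k) (m / 2))
... | false = bitsAsc-shift fuel (suc k) (m / 2)

bitsAsc-fuel : ∀ {fuel fuel′} k m → m ≤ fuel → m ≤ fuel′ → bitsAsc fuel k m ≡ bitsAsc fuel′ k m
bitsAsc-fuel {zero}     {zero}      k m       _  _  = refl
bitsAsc-fuel {zero}     {fuel′}     k zero    _  _  = sym (bitsAsc-zero fuel′ k)
bitsAsc-fuel {fuel}     {zero}      k zero    _  _  = bitsAsc-zero fuel k
bitsAsc-fuel {suc fuel} {suc fuel′} k m       le le′ with binaryView m
... | even x rewrite bitsAsc-even fuel k x | bitsAsc-even fuel′ k x =
  bitsAsc-fuel (suc k) x (m*2≤1+n⇒m≤n le) (m*2≤1+n⇒m≤n le′)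
... | odd x rewrite bitsAsc-odd fuel k x | bitsAsc-odd fuel′ k x =
  cong (k ∷_) (bitsAsc-fuel (suc k) x (1+m*2≤1+n⇒m≤n le) (1+m*2≤1+n⇒m≤n le′))

bits : ℕ → List ℕ
bits m = bitsAsc m 0 m

bits-even : ∀ x → bits (x * 2) ≡ map suc (bits x)
bits-even zero    = refl
bits-even (suc x) = begin
  bitsAsc (suc (suc (x * 2))) 0 (suc x * 2)  ≡⟨ bitsAsc-even (suc (x * 2)) 0 (suc x) ⟩
  bitsAsc (suc (x * 2)) 1 (suc x)            ≡⟨ bitsAsc-shift (suc (x * 2)) 0 (suc x) ⟩
  map suc (bitsAsc (suc (x * 2)) 0 (suc x))  ≡⟨ cong (map suc) (bitsAsc-fuel 0 (suc x) (s≤s (m≤m*n x 2)) ≤-refl) ⟩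
  map suc (bits (suc x))                     ∎
  where open ≡-Reasoning

bits-odd : ∀ x → bits (suc (x * 2)) ≡ 0 ∷ map suc (bits x)
bits-odd x = begin
  bitsAsc (suc (x * 2)) 0 (suc (x * 2))  ≡⟨ bitsAsc-odd (x * 2) 0 x ⟩
  0 ∷ bitsAsc (x * 2) 1 x                ≡⟨ cong (0 ∷_) (bitsAsc-shift (x * 2) 0 x) ⟩
  0 ∷ map suc (bitsAsc (x * 2) 0 x)      ≡⟨ cong (λ bs → 0 ∷ map suc bs) (bitsAsc-fuel 0 x (m≤m*n x 2) ≤-refl) ⟩
  0 ∷ map suc (bits x)                   ∎
  where open ≡-Reasoning

summand : ℕ → ℕ → ℕ
summand i t = t * 2 ^ t + 2 * i * 2 ^ t

revSumTerms : List ℕ → ℕ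
revSumTerms []       = 0
revSumTerms (t ∷ ts) = revSumTerms ts + summand (length ts) t

binaryValue : List ℕ → ℕ
binaryValue []       = 0
binaryValue (t ∷ ts) = 2 ^ t + binaryValue ts

sumTerms-∷ʳ : ∀ i ts t → sumTerms i (ts ∷ʳ t) ≡ sumTerms i ts + summand (i + length ts) t
sumTerms-∷ʳ i []        t = trans (+-identityʳ _) (cong (λ j → summand j t) (sym (+-identityʳ i)))
sumTerms-∷ʳ i (t′ ∷ ts) t = begin
  summand i t′ + sumTerms (suc i) (ts ∷ʳ t)                          ≡⟨ cong (summand i t′ +_) (sumTerms-∷ʳ (suc i) ts t) ⟩
  summand i t′ + (sumTerms (suc i) ts + summand (suc i + length ts) t)  ≡⟨ sym (+-assoc (summand i t′) _ _) ⟩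
  summand i t′ + sumTerms (suc i) ts + summand (suc i + length ts) t    ≡⟨ cong (λ j → summand i t′ + sumTerms (suc i) ts + summand j t) (sym (+-suc i (length ts))) ⟩
  summand i t′ + sumTerms (suc i) ts + summand (i + suc (length ts)) t  ∎
  where open ≡-Reasoning

sumTerms-reverse : ∀ ts → sumTerms 0 (reverse ts) ≡ revSumTerms ts
sumTerms-reverse []       = refl
sumTerms-reverse (t ∷ ts) = begin
  sumTerms 0 (reverse (t ∷ ts))                          ≡⟨ cong (sumTerms 0) (unfold-reverse t ts) ⟩
  sumTerms 0 (reverse ts ∷ʳ t)                           ≡⟨ sumTerms-∷ʳ 0 (reverse ts) t ⟩
  sumTerms 0 (reverse ts) + summand (length (reverse ts)) t ≡⟨ cong₂ (λ s l → s + summand l t) (sumTerms-reverse ts) (length-reverse ts) ⟩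
  revSumTerms ts + summand (length ts) t                       ∎
  where open ≡-Reasoning

revSumTerms-map-suc : ∀ ts → revSumTerms (map suc ts) ≡ 2 * revSumTerms ts + 2 * binaryValue ts
revSumTerms-map-suc []       = refl
revSumTerms-map-suc (t ∷ ts) = begin
  revSumTerms (map suc ts) + summand (length (map suc ts)) (suc t)
    ≡⟨ cong₂ (λ r l → r + summand l (suc t)) (revSumTerms-map-suc ts) (length-map suc ts) ⟩
  2 * revSumTerms ts + 2 * binaryValue ts + summand (length ts) (suc t)
    ≡⟨ solve 5 (λ r v l t p → (con 2 :* r :+ con 2 :* v) :+ ((con 1 :+ t) :* (con 2 :* p) :+ con 2 :* l :* (con 2 :* p))
                           := con 2 :* (r :+ (t :* p :+ con 2 :* l :* p)) :+ con 2 :* (p :+ v))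
               refl (revSumTerms ts) (binaryValue ts) (length ts) t (2 ^ t) ⟩
  2 * (revSumTerms ts + summand (length ts) t) + 2 * (2 ^ t + binaryValue ts) ∎
  where open ≡-Reasoning

binaryValue-map-suc : ∀ ts → binaryValue (map suc ts) ≡ 2 * binaryValue ts
binaryValue-map-suc []       = refl
binaryValue-map-suc (t ∷ ts) rewrite binaryValue-map-suc ts = sym (*-distribˡ-+ 2 (2 ^ t) (binaryValue ts))

binaryValue-bits : ∀ m → binaryValue (bits m) ≡ m
binaryValue-bits = binary-induction (λ m → binaryValue (bits m) ≡ m) refl
  (λ x ih → begin
    binaryValue (bits (x * 2))       ≡⟨ cong binaryValue (bits-even x) ⟩
    binaryValue (map suc (bits x))   ≡⟨ binaryValue-map-suc (bits x) ⟩
    2 * binaryValue (bits x)         ≡⟨ cong (2 *_) ih ⟩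
    2 * x                      ≡⟨ *-comm 2 x ⟩
    x * 2                      ∎)
  (λ x ih → begin
    binaryValue (bits (suc (x * 2)))       ≡⟨ cong binaryValue (bits-odd x) ⟩
    suc (binaryValue (map suc (bits x)))   ≡⟨ cong suc (binaryValue-map-suc (bits x)) ⟩
    suc (2 * binaryValue (bits x))         ≡⟨ cong (λ v → suc (2 * v)) ih ⟩
    suc (2 * x)                      ≡⟨ cong suc (*-comm 2 x) ⟩
    suc (x * 2)                      ∎)
  where open ≡-Reasoning

cubeBound : ℕ → ℕ
cubeBound m = sumTerms 0 (exps m)

popcount : ℕ → ℕ
popcount m = length (bits m)

popcount-even : ∀ x → popcount (x * 2) ≡ popcount x
popcount-even x = trans (cong length (bits-even x)) (length-map suc (bits x))

popcount-odd : ∀ x → popcount (suc (x * 2)) ≡ suc (popcount x)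
popcount-odd x = trans (cong length (bits-odd x)) (cong suc (length-map suc (bits x)))

revSumTerms-shifted-bits : ∀ x → revSumTerms (map suc (bits x)) ≡ 2 * cubeBound x + 2 * x
revSumTerms-shifted-bits x = begin
  revSumTerms (map suc (bits x))                  ≡⟨ revSumTerms-map-suc (bits x) ⟩
  2 * revSumTerms (bits x) + 2 * binaryValue (bits x)   ≡⟨ cong₂ (λ r v → 2 * r + 2 * v) (sym (sumTerms-reverse (bits x))) (binaryValue-bits x) ⟩
  2 * cubeBound x + 2 * x                      ∎
  where open ≡-Reasoning

cubeBound-even : ∀ x → cubeBound (x * 2) ≡ cubeBound x + cubeBound x + x * 2
cubeBound-even x = begin
  cubeBound (x * 2)                    ≡⟨ sumTerms-reverse (bits (x * 2)) ⟩
  revSumTerms (bits (x * 2))              ≡⟨ cong revSumTerms (bits-even x) ⟩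
  revSumTerms (map suc (bits x))          ≡⟨ revSumTerms-shifted-bits x ⟩
  2 * cubeBound x + 2 * x              ≡⟨ solve 2 (λ h x → con 2 :* h :+ con 2 :* x := h :+ h :+ x :* con 2) refl (cubeBound x) x ⟩
  cubeBound x + cubeBound x + x * 2    ∎
  where open ≡-Reasoning

cubeBound-odd-popcount : ∀ x → cubeBound (suc (x * 2)) ≡ 2 * cubeBound x + 2 * x + 2 * popcount x
cubeBound-odd-popcount x = begin
  cubeBound (suc (x * 2))                                           ≡⟨ sumTerms-reverse (bits (suc (x * 2))) ⟩
  revSumTerms (bits (suc (x * 2)))                                     ≡⟨ cong revSumTerms (bits-odd x) ⟩
  revSumTerms (map suc (bits x)) + 2 * length (map suc (bits x)) * 1  ≡⟨ cong₂ _+_ (revSumTerms-shifted-bits x) (*-identityʳ _) ⟩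
  2 * cubeBound x + 2 * x + 2 * length (map suc (bits x))          ≡⟨ cong (λ l → 2 * cubeBound x + 2 * x + 2 * l) (length-map suc (bits x)) ⟩
  2 * cubeBound x + 2 * x + 2 * popcount x                          ∎
  where open ≡-Reasoning

cubeBound-suc : ∀ m → cubeBound (suc m) ≡ cubeBound m + 2 * popcount m
cubeBound-suc = binary-induction (λ m → cubeBound (suc m) ≡ cubeBound m + 2 * popcount m) refl
  (λ x _ → begin
    cubeBound (suc (x * 2))                                ≡⟨ cubeBound-odd-popcount x ⟩
    2 * cubeBound x + 2 * x + 2 * popcount x               ≡⟨ solve 3 (λ h x c → con 2 :* h :+ con 2 :* x :+ con 2 :* c
                                                                              := h :+ h :+ x :* con 2 :+ con 2 :* c)
                                                                  refl (cubeBound x) x (popcount x) ⟩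
    cubeBound x + cubeBound x + x * 2 + 2 * popcount x     ≡⟨ cong₂ (λ h c → h + 2 * c) (sym (cubeBound-even x)) (sym (popcount-even x)) ⟩
    cubeBound (x * 2) + 2 * popcount (x * 2)               ∎)
  (λ x ih → begin
    cubeBound (suc x * 2)                                            ≡⟨ cubeBound-even (suc x) ⟩
    cubeBound (suc x) + cubeBound (suc x) + suc x * 2                ≡⟨ cong (λ h → h + h + suc x * 2) ih ⟩
    (cubeBound x + 2 * popcount x) + (cubeBound x + 2 * popcount x) + suc x * 2
      ≡⟨ solve 3 (λ h c x → (h :+ con 2 :* c) :+ (h :+ con 2 :* c) :+ (con 1 :+ x) :* con 2
                          := con 2 :* h :+ con 2 :* x :+ con 2 :* c :+ con 2 :* (con 1 :+ c))
           refl (cubeBound x) (popcount x) x ⟩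
    2 * cubeBound x + 2 * x + 2 * popcount x + 2 * suc (popcount x)
      ≡⟨ cong₂ (λ h c → h + 2 * c) (sym (cubeBound-odd-popcount x)) (sym (popcount-odd x)) ⟩
    cubeBound (suc (x * 2)) + 2 * popcount (suc (x * 2))             ∎)
  where open ≡-Reasoning

cubeBound-odd : ∀ x → cubeBound (suc (x * 2)) ≡ cubeBound x + cubeBound (suc x) + x * 2
cubeBound-odd x = begin
  cubeBound (suc (x * 2))                             ≡⟨ cubeBound-odd-popcount x ⟩
  2 * cubeBound x + 2 * x + 2 * popcount x            ≡⟨ solve 3 (λ h x c → con 2 :* h :+ con 2 :* x :+ con 2 :* c
                                                                   := h :+ (h :+ con 2 :* c) :+ x :* con 2)
                                                           refl (cubeBound x) x (popcount x) ⟩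
  cubeBound x + (cubeBound x + 2 * popcount x) + x * 2  ≡⟨ cong (λ h → cubeBound x + h + x * 2) (sym (cubeBound-suc x)) ⟩
  cubeBound x + cubeBound (suc x) + x * 2             ∎
  where open ≡-Reasoning

MinSuperadditive : (ℕ → ℕ) → ℕ → ℕ → Set
MinSuperadditive F a b = F a + F b + 2 * (a ⊓ b) ≤ F (a + b)

MinSuperadditive-sym : ∀ F {a b} → MinSuperadditive F a b → MinSuperadditive F b a
MinSuperadditive-sym F {a} {b} =
  subst₂ _≤_ (cong₂ _+_ (+-comm (F a) (F b)) (cong (2 *_) (⊓-comm a b))) (cong F (+-comm a b))

⊓-even-odd : ∀ x y → x * 2 ⊓ suc (y * 2) ≤ x ⊓ y + x ⊓ suc y
⊓-even-odd zero    y       = z≤n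
⊓-even-odd (suc x) zero    = s≤s z≤n
⊓-even-odd (suc x) (suc y) =
  subst (suc (suc (x * 2 ⊓ suc (y * 2))) ≤_) (sym (+-suc (suc (x ⊓ y)) (x ⊓ suc y))) (s≤s (s≤s (⊓-even-odd x y)))

m*2≤2*n⇒m≤n : ∀ {x n} → x * 2 ≤ 2 * n → x ≤ n
m*2≤2*n⇒m≤n {x} {n} le = *-cancelʳ-≤ x n 2 (subst (x * 2 ≤_) (*-comm 2 n) le)

1+m*2≤2*n⇒1+m≤n : ∀ {x n} → suc (x * 2) ≤ 2 * n → suc x ≤ n
1+m*2≤2*n⇒1+m≤n {x} {n} le = *-cancelʳ-< 2 x n (subst (x * 2 <_) (*-comm 2 n) le)

n<2^n : ∀ n → n < 2 ^ n
n<2^n zero    = s≤s z≤n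
n<2^n (suc n) = begin-strict
  1 + n            <⟨ +-mono-≤-< (m^n>0 2 n) (n<2^n n) ⟩
  2 ^ n + 2 ^ n    ≡⟨ cong (2 ^ n +_) (sym (+-identityʳ (2 ^ n))) ⟩
  2 ^ suc n        ∎
  where open ≤-Reasoning

module HalvingRecurrence {F : ℕ → ℕ}
  (F-even : ∀ x → F (x * 2) ≡ F x + F x + x * 2)
  (F-odd  : ∀ x → F (suc (x * 2)) ≡ F x + F (suc x) + x * 2) where

  F-zero : F 0 ≡ 0
  F-zero = +-cancelˡ-≡ (F 0) (F 0) 0 (begin
    F 0 + F 0      ≡⟨ sym (+-identityʳ (F 0 + F 0)) ⟩
    F 0 + F 0 + 0  ≡⟨ sym (F-even 0) ⟩
    F 0            ≡⟨ sym (+-identityʳ (F 0)) ⟩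
    F 0 + 0        ∎)
    where open ≡-Reasoning

  superadditive-zeroˡ : ∀ b → MinSuperadditive F 0 b
  superadditive-zeroˡ b rewrite F-zero = ≤-reflexive (+-identityʳ (F b))

  superadditive-even-even : ∀ {x y} → MinSuperadditive F x y → MinSuperadditive F (x * 2) (y * 2)
  superadditive-even-even {x} {y} ih = begin
    F (x * 2) + F (y * 2) + 2 * (x * 2 ⊓ (y * 2))
      ≡⟨ cong₂ _+_ (cong₂ _+_ (F-even x) (F-even y)) (cong (2 *_) (sym (*-distribʳ-⊓ 2 x y))) ⟩
    (F x + F x + x * 2) + (F y + F y + y * 2) + 2 * ((x ⊓ y) * 2)
      ≡⟨ solve 5 (λ a b x y m → (a :+ a :+ x :* con 2) :+ (b :+ b :+ y :* con 2) :+ con 2 :* (m :* con 2)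
                             := (a :+ b :+ con 2 :* m) :+ (a :+ b :+ con 2 :* m) :+ (x :+ y) :* con 2)
                 refl (F x) (F y) x y (x ⊓ y) ⟩
    (F x + F y + 2 * (x ⊓ y)) + (F x + F y + 2 * (x ⊓ y)) + (x + y) * 2
      ≤⟨ +-monoˡ-≤ ((x + y) * 2) (+-mono-≤ ih ih) ⟩
    F (x + y) + F (x + y) + (x + y) * 2
      ≡⟨ sym (F-even (x + y)) ⟩
    F ((x + y) * 2)
      ≡⟨ cong F (*-distribʳ-+ 2 x y) ⟩
    F (x * 2 + y * 2) ∎
    where open ≤-Reasoning

  superadditive-even-odd : ∀ {x y} → MinSuperadditive F x y → MinSuperadditive F x (suc y) →
                           MinSuperadditive F (x * 2) (suc (y * 2))
  superadditive-even-odd {x} {y} ih ih′ = begin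
    F (x * 2) + F (suc (y * 2)) + 2 * (x * 2 ⊓ suc (y * 2))
      ≤⟨ +-monoʳ-≤ (F (x * 2) + F (suc (y * 2))) (*-monoʳ-≤ 2 (⊓-even-odd x y)) ⟩
    F (x * 2) + F (suc (y * 2)) + 2 * (x ⊓ y + x ⊓ suc y)
      ≡⟨ cong₂ (λ p q → p + q + 2 * (x ⊓ y + x ⊓ suc y)) (F-even x) (F-odd y) ⟩
    (F x + F x + x * 2) + (F y + F (suc y) + y * 2) + 2 * (x ⊓ y + x ⊓ suc y)
      ≡⟨ solve 7 (λ a b b′ x y m m′ → (a :+ a :+ x :* con 2) :+ (b :+ b′ :+ y :* con 2) :+ con 2 :* (m :+ m′)
                                   := (a :+ b :+ con 2 :* m) :+ (a :+ b′ :+ con 2 :* m′) :+ (x :+ y) :* con 2)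
                 refl (F x) (F y) (F (suc y)) x y (x ⊓ y) (x ⊓ suc y) ⟩
    (F x + F y + 2 * (x ⊓ y)) + (F x + F (suc y) + 2 * (x ⊓ suc y)) + (x + y) * 2
      ≤⟨ +-monoˡ-≤ ((x + y) * 2) (+-mono-≤ ih (subst (λ z → F x + F (suc y) + 2 * (x ⊓ suc y) ≤ F z) (+-suc x y) ih′)) ⟩
    F (x + y) + F (suc (x + y)) + (x + y) * 2
      ≡⟨ sym (F-odd (x + y)) ⟩
    F (suc ((x + y) * 2))
      ≡⟨ cong F (solve 2 (λ x y → con 1 :+ (x :+ y) :* con 2 := x :* con 2 :+ (con 1 :+ y :* con 2)) refl x y) ⟩
    F (x * 2 + suc (y * 2)) ∎
    where open ≤-Reasoning

  superadditive-odd-odd : ∀ {x y} → MinSuperadditive F x (suc y) → MinSuperadditive F (suc x) y →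
                          MinSuperadditive F (suc (x * 2)) (suc (y * 2))
  superadditive-odd-odd {x} {y} ih ih′ = begin
    F (suc (x * 2)) + F (suc (y * 2)) + 2 * suc (x * 2 ⊓ (y * 2))
      ≡⟨ cong₂ _+_ (cong₂ _+_ (F-odd x) (F-odd y)) (cong (λ m → 2 * suc m) (sym (*-distribʳ-⊓ 2 x y))) ⟩
    (F x + F (suc x) + x * 2) + (F y + F (suc y) + y * 2) + 2 * suc ((x ⊓ y) * 2)
      ≡⟨ solve 7 (λ a a′ b b′ x y m → (a :+ a′ :+ x :* con 2) :+ (b :+ b′ :+ y :* con 2) :+ con 2 :* (con 1 :+ m :* con 2)
                                   := (a :+ b′ :+ con 2 :* m) :+ (a′ :+ b :+ con 2 :* m) :+ (con 1 :+ x :+ y) :* con 2)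
                 refl (F x) (F (suc x)) (F y) (F (suc y)) x y (x ⊓ y) ⟩
    (F x + F (suc y) + 2 * (x ⊓ y)) + (F (suc x) + F y + 2 * (x ⊓ y)) + (suc x + y) * 2
      ≤⟨ +-monoˡ-≤ ((suc x + y) * 2) (+-mono-≤
           (+-monoʳ-≤ (F x + F (suc y)) (*-monoʳ-≤ 2 (⊓-monoʳ-≤ x (n≤1+n y))))
           (+-monoʳ-≤ (F (suc x) + F y) (*-monoʳ-≤ 2 (⊓-monoˡ-≤ y (n≤1+n x))))) ⟩
    (F x + F (suc y) + 2 * (x ⊓ suc y)) + (F (suc x) + F y + 2 * (suc x ⊓ y)) + (suc x + y) * 2
      ≤⟨ +-monoˡ-≤ ((suc x + y) * 2) (+-mono-≤ (subst (λ z → F x + F (suc y) + 2 * (x ⊓ suc y) ≤ F z) (+-suc x y) ih) ih′) ⟩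
    F (suc x + y) + F (suc x + y) + (suc x + y) * 2
      ≡⟨ sym (F-even (suc x + y)) ⟩
    F ((suc x + y) * 2)
      ≡⟨ cong F (solve 2 (λ x y → (con 1 :+ x :+ y) :* con 2 := con 1 :+ x :* con 2 :+ (con 1 :+ y :* con 2)) refl x y) ⟩
    F (suc (x * 2) + suc (y * 2)) ∎
    where open ≤-Reasoning

  -- Both halves ⌊m/2⌋, ⌈m/2⌉ of an m ≤ 2 ^ (k + 1) are ≤ 2 ^ k, which bounds the recursion.
  superadditive-≤2^ : ∀ k {a b} → a ≤ 2 ^ k → b ≤ 2 ^ k → MinSuperadditive F a b
  superadditive-≤2^ zero    {0}     {b}     _         _         = superadditive-zeroˡ b
  superadditive-≤2^ zero    {1}     {0}     _         _         = MinSuperadditive-sym F (superadditive-zeroˡ 1)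
  superadditive-≤2^ zero    {1}     {1}     _         _         = ≤-reflexive (sym (F-even 1))
  superadditive-≤2^ zero    {2+ _}  {_}     (s≤s ())  _
  superadditive-≤2^ zero    {1}     {2+ _}  _         (s≤s ())
  superadditive-≤2^ (suc k) {a}     {b}     a≤        b≤        with binaryView a | binaryView b
  ... | even x | even y = superadditive-even-even (superadditive-≤2^ k {x} {y} (m*2≤2*n⇒m≤n a≤) (m*2≤2*n⇒m≤n b≤))
  ... | even x | odd y  = superadditive-even-odd
                            (superadditive-≤2^ k {x} {y} (m*2≤2*n⇒m≤n a≤) (<⇒≤ (1+m*2≤2*n⇒1+m≤n b≤)))
                            (superadditive-≤2^ k {x} {suc y} (m*2≤2*n⇒m≤n a≤) (1+m*2≤2*n⇒1+m≤n b≤))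
  ... | odd x  | even y = MinSuperadditive-sym F (superadditive-even-odd
                            (superadditive-≤2^ k {y} {x} (m*2≤2*n⇒m≤n b≤) (<⇒≤ (1+m*2≤2*n⇒1+m≤n a≤)))
                            (superadditive-≤2^ k {y} {suc x} (m*2≤2*n⇒m≤n b≤) (1+m*2≤2*n⇒1+m≤n a≤)))
  ... | odd x  | odd y  = superadditive-odd-odd
                            (superadditive-≤2^ k {x} {suc y} (<⇒≤ (1+m*2≤2*n⇒1+m≤n a≤)) (1+m*2≤2*n⇒1+m≤n b≤))
                            (superadditive-≤2^ k {suc x} {y} (1+m*2≤2*n⇒1+m≤n a≤) (<⇒≤ (1+m*2≤2*n⇒1+m≤n b≤)))

  superadditive : ∀ a b → MinSuperadditive F a b
  superadditive a b = superadditive-≤2^ (a + b) (≤-trans (m≤m+n a b) a+b≤2^[a+b]) (≤-trans (m≤n+m b a) a+b≤2^[a+b])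
    where
    a+b≤2^[a+b] : a + b ≤ 2 ^ (a + b)
    a+b≤2^[a+b] = <⇒≤ (n<2^n (a + b))

-- Twice the number of edges gained by completing each block of four vertices, and a final
-- triple, to a clique.
k4Excess : ℕ → ℕ
k4Excess 0                          = 0
k4Excess 1                          = 0
k4Excess 2                          = 0
k4Excess 3                          = 2
k4Excess (suc (suc (suc (suc m)))) = 4 + k4Excess m

k4Excess-divMod : ∀ m → 4 * (m / 4) + (if m % 4 ≡ᵇ 3 then 2 else 0) ≡ k4Excess m
k4Excess-divMod 0 = refl
k4Excess-divMod 1 = refl
k4Excess-divMod 2 = refl
k4Excess-divMod 3 = refl
k4Excess-divMod (suc (suc (suc (suc m)))) = begin
  4 * ((4 + m) / 4) + (if (4 + m) % 4 ≡ᵇ 3 then 2 else 0)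
    ≡⟨ cong₂ (λ d r → 4 * d + (if r ≡ᵇ 3 then 2 else 0))
             (m/n≡1+[m∸n]/n {4 + m} {4} (s≤s (s≤s (s≤s (s≤s z≤n)))))
             (trans (cong (_% 4) (+-comm 4 m)) ([m+n]%n≡m%n m 4)) ⟩
  4 * (1 + m / 4) + r
    ≡⟨ solve 2 (λ d r → con 4 :* (con 1 :+ d) :+ r := con 4 :+ (con 4 :* d :+ r)) refl (m / 4) r ⟩
  4 + (4 * (m / 4) + r)
    ≡⟨ cong (4 +_) (k4Excess-divMod m) ⟩
  4 + k4Excess m ∎
  where
  open ≡-Reasoning
  r = if m % 4 ≡ᵇ 3 then 2 else 0

f≡cubeBound+k4Excess : ∀ m → f m ≡ cubeBound m + k4Excess m
f≡cubeBound+k4Excess m = trans (+-assoc (cubeBound m) (4 * (m / 4)) _) (cong (cubeBound m +_) (k4Excess-divMod m))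

k4Excess-superadditive : ∀ a b → k4Excess a + k4Excess b ≤ k4Excess (a + b)
k4Excess-superadditive (suc (suc (suc (suc a)))) b = +-monoʳ-≤ 4 (k4Excess-superadditive a b)
k4Excess-superadditive a (suc (suc (suc (suc b)))) = begin
  k4Excess a + (4 + k4Excess b)  ≡⟨ shift4 (k4Excess a) (k4Excess b) ⟩
  4 + (k4Excess a + k4Excess b)  ≤⟨ +-monoʳ-≤ 4 (k4Excess-superadditive a b) ⟩
  4 + k4Excess (a + b)           ≡⟨ cong k4Excess (sym (shift4 a b)) ⟩
  k4Excess (a + (4 + b))         ∎
  where
  open ≤-Reasoning
  shift4 : ∀ x y → x + (4 + y) ≡ 4 + (x + y)
  shift4 = solve 2 (λ x y → x :+ (con 4 :+ y) := con 4 :+ (x :+ y)) refl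
k4Excess-superadditive 0 b = ≤-refl
k4Excess-superadditive a 0 = ≤-reflexive (trans (+-identityʳ (k4Excess a)) (cong k4Excess (sym (+-identityʳ a))))
k4Excess-superadditive 1 1 = ≤ᵇ⇒≤ _ _ _
k4Excess-superadditive 1 2 = ≤ᵇ⇒≤ _ _ _
k4Excess-superadditive 1 3 = ≤ᵇ⇒≤ _ _ _
k4Excess-superadditive 2 1 = ≤ᵇ⇒≤ _ _ _
k4Excess-superadditive 2 2 = ≤ᵇ⇒≤ _ _ _
k4Excess-superadditive 2 3 = ≤ᵇ⇒≤ _ _ _
k4Excess-superadditive 3 1 = ≤ᵇ⇒≤ _ _ _
k4Excess-superadditive 3 2 = ≤ᵇ⇒≤ _ _ _
k4Excess-superadditive 3 3 = ≤ᵇ⇒≤ _ _ _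

cubeBound-superadditive : ∀ a b → MinSuperadditive cubeBound a b
cubeBound-superadditive = HalvingRecurrence.superadditive {cubeBound} cubeBound-even cubeBound-odd

f-superadditive : ∀ a b → MinSuperadditive f a b
f-superadditive a b = begin
  f a + f b + 2 * (a ⊓ b)
    ≡⟨ cong₂ (λ fa fb → fa + fb + 2 * (a ⊓ b)) (f≡cubeBound+k4Excess a) (f≡cubeBound+k4Excess b) ⟩
  (cubeBound a + k4Excess a) + (cubeBound b + k4Excess b) + 2 * (a ⊓ b)
    ≡⟨ solve 5 (λ x y u v m → (x :+ u) :+ (y :+ v) :+ m := (x :+ y :+ m) :+ (u :+ v))
               refl (cubeBound a) (cubeBound b) (k4Excess a) (k4Excess b) (2 * (a ⊓ b)) ⟩
  (cubeBound a + cubeBound b + 2 * (a ⊓ b)) + (k4Excess a + k4Excess b)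
    ≤⟨ +-mono-≤ (cubeBound-superadditive a b) (k4Excess-superadditive a b) ⟩
  cubeBound (a + b) + k4Excess (a + b)
    ≡⟨ sym (f≡cubeBound+k4Excess (a + b)) ⟩
  f (a + b) ∎
  where open ≤-Reasoning

indicator : Bool → ℕ
indicator b = if b then 1 else 0

∑-mono-≤ : ∀ {n} {g h : Fin n → ℕ} → (∀ i → g i ≤ h i) → sum g ≤ sum h
∑-mono-≤ {zero}  _   = z≤n
∑-mono-≤ {suc n} g≤h = +-mono-≤ (g≤h zero) (∑-mono-≤ (g≤h ∘ suc))

∑-↑ : ∀ m n (g : Fin (m + n) → ℕ) → sum g ≡ ∑[ i < m ] g (i ↑ˡ n) + ∑[ j < n ] g (m ↑ʳ j)
∑-↑ zero    n g = refl
∑-↑ (suc m) n g = trans (cong (g zero +_) (∑-↑ m n (g ∘ suc))) (sym (+-assoc (g zero) _ _))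

sumᴸ-map-tabulate : ∀ {A : Set} n (e : Fin n → A) (g : A → ℕ) →
                    sumᴸ (map g (List.tabulate e)) ≡ ∑[ i < n ] g (e i)
sumᴸ-map-tabulate zero    e g = refl
sumᴸ-map-tabulate (suc n) e g = cong (g (e zero) +_) (sumᴸ-map-tabulate n (e ∘ suc) g)

∣∣≡∑ : ∀ {n} (X : Subset n) → ∣ X ∣ ≡ ∑[ i < n ] indicator (lookup X i)
∣∣≡∑ []          = refl
∣∣≡∑ (true ∷ X)  = cong suc (∣∣≡∑ X)
∣∣≡∑ (false ∷ X) = ∣∣≡∑ X

∣tabulate∣ : ∀ {n} (p : Fin n → Bool) → ∣ tabulate p ∣ ≡ ∑[ i < n ] indicator (p i)
∣tabulate∣ p = trans (∣∣≡∑ (tabulate p)) (sum-cong-≗ (cong indicator ∘ lookup∘tabulate p))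

∧-∧-false : ∀ a b → a ∧ b ∧ false ≡ false
∧-∧-false a b = trans (cong (a ∧_) (∧-zeroʳ b)) (∧-zeroʳ a)

∑-indicator-≟ : ∀ {n} (w : Fin n) (c : Bool) (g : Fin n → Bool) →
                ∑[ v < n ] indicator (c ∧ g v ∧ does (w ≟ v)) ≡ indicator (c ∧ g w)
∑-indicator-≟ {suc n} zero c g = begin
  indicator (c ∧ g zero ∧ true) + ∑[ v < n ] indicator (c ∧ g (suc v) ∧ false)
    ≡⟨ cong₂ _+_ (cong (λ b → indicator (c ∧ b)) (∧-identityʳ (g zero)))
                 (trans (sum-cong-≗ (λ v → cong indicator (∧-∧-false c (g (suc v))))) (sum-replicate-zero n)) ⟩
  indicator (c ∧ g zero) + 0
    ≡⟨ +-identityʳ _ ⟩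
  indicator (c ∧ g zero) ∎
  where open ≡-Reasoning
∑-indicator-≟ {suc n} (suc w) c g =
  cong₂ _+_ (cong indicator (∧-∧-false c (g zero))) (∑-indicator-≟ w c (g ∘ suc))

indicator-∧₃-cong : ∀ {p p′ q q′ e e′} → p ≡ p′ → q ≡ q′ → e ≡ e′ →
                    indicator (p ∧ q ∧ e) ≡ indicator (p′ ∧ q′ ∧ e′)
indicator-∧₃-cong refl refl refl = refl

Undirected : Graph → Set
Undirected G = ∀ u v → adj G u v ≡ adj G v u

-- Counts every edge of G[X] twice when G is undirected and loopless.
arcsIn : (G : Graph) → Subset (size G) → ℕ
arcsIn G X = ∑[ u < size G ] ∑[ v < size G ] indicator (lookup X u ∧ lookup X v ∧ adj G u v)

ArcBound : (ℕ → ℕ) → Graph → Set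
ArcBound F G = ∀ X → arcsIn G X ≤ F ∣ X ∣

indicator-disjoint : ∀ p q b → (T p → T q → ⊥) → indicator (p ∧ b) + indicator (q ∧ b) ≤ indicator b
indicator-disjoint true  true  b     p⇒¬q = ⊥-elim (p⇒¬q _ _)
indicator-disjoint true  false true  _    = ≤-refl
indicator-disjoint true  false false _    = ≤-refl
indicator-disjoint false true  b     _    = ≤-refl
indicator-disjoint false false b     _    = z≤n

2*edgesIn≤arcsIn : ∀ G → Undirected G → ∀ X → 2 * edgesIn G X ≤ arcsIn G X
2*edgesIn≤arcsIn G undirected X = begin
  2 * edgesIn G X
    ≡⟨ cong (λ e → e + (e + 0)) edgesIn≡ ⟩
  E + (E + 0)
    ≡⟨ cong (E +_) (trans (+-identityʳ E) (∑-comm (λ u v → indicator (before u v ∧ inX u v)))) ⟩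
  E + ∑[ u < n ] ∑[ v < n ] indicator (before v u ∧ inX v u)
    ≡⟨ sym (∑-distrib-+ (λ u → ∑[ v < n ] indicator (before u v ∧ inX u v)) _) ⟩
  ∑[ u < n ] (∑[ v < n ] indicator (before u v ∧ inX u v) + ∑[ v < n ] indicator (before v u ∧ inX v u))
    ≡⟨ sum-cong-≗ (λ u → sym (∑-distrib-+ (λ v → indicator (before u v ∧ inX u v)) _)) ⟩
  ∑[ u < n ] ∑[ v < n ] (indicator (before u v ∧ inX u v) + indicator (before v u ∧ inX v u))
    ≤⟨ ∑-mono-≤ (λ u → ∑-mono-≤ (λ v →
         subst (λ b → indicator (before u v ∧ inX u v) + indicator (before v u ∧ b) ≤ indicator (inX u v))
               (sym (inX-sym u v))
               (indicator-disjoint (before u v) (before v u) (inX u v) (before-asym u v)))) ⟩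
  arcsIn G X ∎
  where
  open ≤-Reasoning
  n = size G
  before : Fin n → Fin n → Bool
  before u v = toℕ u <ᵇ toℕ v
  inX : Fin n → Fin n → Bool
  inX u v = lookup X u ∧ lookup X v ∧ adj G u v
  E = ∑[ u < n ] ∑[ v < n ] indicator (before u v ∧ inX u v)
  edgesIn≡ : edgesIn G X ≡ E
  edgesIn≡ = trans (sumᴸ-map-tabulate n (λ u → u) _)
                   (sum-cong-≗ (λ u → sumᴸ-map-tabulate n (λ v → v) (λ v → indicator (before u v ∧ inX u v))))
  before-asym : ∀ u v → T (before u v) → T (before v u) → ⊥
  before-asym u v u<v v<u = <-asym (<ᵇ⇒< (toℕ u) (toℕ v) u<v) (<ᵇ⇒< (toℕ v) (toℕ u) v<u)
  inX-sym : ∀ u v → inX v u ≡ inX u v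
  inX-sym u v = trans (cong (λ a → lookup X v ∧ lookup X u ∧ a) (undirected v u)) (∧-exchange (lookup X v) (lookup X u) _)

module _ {G H : Graph} (G≅H : G ≅ H) where
  private
    σ    = _≅_.bij G≅H
    to   = Inverse.to σ
    from = Inverse.from σ

  transport : Subset (size G) → Subset (size H)
  transport X = tabulate (lookup X ∘ from)

  lookup-transport : ∀ X u → lookup (transport X) (to u) ≡ lookup X u
  lookup-transport X u = trans (lookup∘tabulate (lookup X ∘ from) (to u)) (cong (lookup X) (Inverse.inverseʳ σ refl))

  ∣transport∣ : ∀ X → ∣ transport X ∣ ≡ ∣ X ∣
  ∣transport∣ X = begin
    ∣ transport X ∣                                   ≡⟨ ∣∣≡∑ (transport X) ⟩
    ∑[ v < size H ] indicator (lookup (transport X) v)  ≡⟨ sum-permute _ σ ⟩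
    ∑[ u < size G ] indicator (lookup (transport X) (to u)) ≡⟨ sum-cong-≗ (cong indicator ∘ lookup-transport X) ⟩
    ∑[ u < size G ] indicator (lookup X u)             ≡⟨ sym (∣∣≡∑ X) ⟩
    ∣ X ∣                                             ∎
    where open ≡-Reasoning

  arcsIn-transport : ∀ X → arcsIn H (transport X) ≡ arcsIn G X
  arcsIn-transport X = begin
    ∑[ u < size H ] ∑[ v < size H ] arc u v                   ≡⟨ sum-permute _ σ ⟩
    ∑[ u < size G ] ∑[ v < size H ] arc (to u) v              ≡⟨ sum-cong-≗ (λ u → sum-permute (arc (to u)) σ) ⟩
    ∑[ u < size G ] ∑[ v < size G ] arc (to u) (to v)         ≡⟨ sum-cong-≗ (λ u → sum-cong-≗ (λ v →
                                                                   indicator-∧₃-cong (lookup-transport X u) (lookup-transport X v)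
                                                                                     (sym (_≅_.adj-pres G≅H u v)))) ⟩
    arcsIn G X                                                ∎
    where
    open ≡-Reasoning
    arc : Fin (size H) → Fin (size H) → ℕ
    arc u v = indicator (lookup (transport X) u ∧ lookup (transport X) v ∧ adj H u v)

  ArcBound-≅ : ∀ {F} → ArcBound F H → ArcBound F G
  ArcBound-≅ {F} bound X = subst₂ _≤_ (arcsIn-transport X) (cong F (∣transport∣ X)) (bound (transport X))

  Undirected-≅ : Undirected H → Undirected G
  Undirected-≅ undirected u v = begin
    adj G u v          ≡⟨ _≅_.adj-pres G≅H u v ⟩
    adj H (to u) (to v) ≡⟨ undirected (to u) (to v) ⟩
    adj H (to v) (to u) ≡⟨ sym (_≅_.adj-pres G≅H v u) ⟩
    adj G v u          ∎
    where open ≡-Reasoning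

∑∑-↑ : ∀ m n (g : Fin (m + n) → Fin (m + n) → ℕ) →
       ∑[ x < m + n ] ∑[ y < m + n ] g x y ≡
         (∑[ u < m ] ∑[ u′ < m ] g (u ↑ˡ n) (u′ ↑ˡ n) + ∑[ u < m ] ∑[ v′ < n ] g (u ↑ˡ n) (m ↑ʳ v′)) +
         (∑[ v < n ] ∑[ u′ < m ] g (m ↑ʳ v) (u′ ↑ˡ n) + ∑[ v < n ] ∑[ v′ < n ] g (m ↑ʳ v) (m ↑ʳ v′))
∑∑-↑ m n g = begin
  ∑[ x < m + n ] ∑[ y < m + n ] g x y
    ≡⟨ ∑-↑ m n _ ⟩
  ∑[ u < m ] ∑[ y < m + n ] g (u ↑ˡ n) y + ∑[ v < n ] ∑[ y < m + n ] g (m ↑ʳ v) y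
    ≡⟨ cong₂ _+_ (sum-cong-≗ (λ u → ∑-↑ m n (g (u ↑ˡ n)))) (sum-cong-≗ (λ v → ∑-↑ m n (g (m ↑ʳ v)))) ⟩
  ∑[ u < m ] (∑[ u′ < m ] g (u ↑ˡ n) (u′ ↑ˡ n) + ∑[ v′ < n ] g (u ↑ˡ n) (m ↑ʳ v′)) +
  ∑[ v < n ] (∑[ u′ < m ] g (m ↑ʳ v) (u′ ↑ˡ n) + ∑[ v′ < n ] g (m ↑ʳ v) (m ↑ʳ v′))
    ≡⟨ cong₂ _+_ (∑-distrib-+ (λ u → ∑[ u′ < m ] g (u ↑ˡ n) (u′ ↑ˡ n)) (λ u → ∑[ v′ < n ] g (u ↑ˡ n) (m ↑ʳ v′)))
                 (∑-distrib-+ (λ v → ∑[ u′ < m ] g (m ↑ʳ v) (u′ ↑ˡ n)) (λ v → ∑[ v′ < n ] g (m ↑ʳ v) (m ↑ʳ v′))) ⟩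
  (∑[ u < m ] ∑[ u′ < m ] g (u ↑ˡ n) (u′ ↑ˡ n) + ∑[ u < m ] ∑[ v′ < n ] g (u ↑ˡ n) (m ↑ʳ v′)) +
  (∑[ v < n ] ∑[ u′ < m ] g (m ↑ʳ v) (u′ ↑ˡ n) + ∑[ v < n ] ∑[ v′ < n ] g (m ↑ʳ v) (m ↑ʳ v′)) ∎
  where open ≡-Reasoning

indicator-∧-≤ˡ : ∀ a b → indicator (a ∧ b) ≤ indicator a
indicator-∧-≤ˡ true  true  = ≤-refl
indicator-∧-≤ˡ true  false = z≤n
indicator-∧-≤ˡ false b     = z≤n

indicator-∧-≤ʳ : ∀ a b → indicator (a ∧ b) ≤ indicator b
indicator-∧-≤ʳ true  b = ≤-refl
indicator-∧-≤ʳ false b = z≤n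

matchedIn : ∀ {m n} → Fin m ↔ Fin n → Subset m → Subset n → ℕ
matchedIn {m} π X Y = ∑[ u < m ] indicator (lookup X u ∧ lookup Y (Inverse.to π u))

∑∑≡matchedIn : ∀ {m n} (π : Fin m ↔ Fin n) X Y →
               ∑[ u < m ] ∑[ v < n ] indicator (lookup X u ∧ lookup Y v ∧ does (Inverse.to π u ≟ v)) ≡ matchedIn π X Y
∑∑≡matchedIn π X Y = sum-cong-≗ (λ u → ∑-indicator-≟ (Inverse.to π u) (lookup X u) (lookup Y))

matchedIn≤⊓ : ∀ {m n} (π : Fin m ↔ Fin n) X Y → matchedIn π X Y ≤ ∣ X ∣ ⊓ ∣ Y ∣
matchedIn≤⊓ {m} {n} π X Y = ⊓-glb
  (begin
    matchedIn π X Y                      ≤⟨ ∑-mono-≤ (λ u → indicator-∧-≤ˡ (lookup X u) _) ⟩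
    ∑[ u < m ] indicator (lookup X u)    ≡⟨ sym (∣∣≡∑ X) ⟩
    ∣ X ∣                                ∎)
  (begin
    matchedIn π X Y                                    ≤⟨ ∑-mono-≤ (λ u → indicator-∧-≤ʳ (lookup X u) _) ⟩
    ∑[ u < m ] indicator (lookup Y (Inverse.to π u))   ≡⟨ sym (sum-permute _ π) ⟩
    ∑[ v < n ] indicator (lookup Y v)                  ≡⟨ sym (∣∣≡∑ Y) ⟩
    ∣ Y ∣                                              ∎)
  where open ≤-Reasoning

module _ (G₀ G₁ : Graph) (π : Fin (size G₀) ↔ Fin (size G₁)) where
  private
    n₀ = size G₀
    n₁ = size G₁
    J  = join G₀ G₁ π
    to = Inverse.to π

  adj-join-ˡˡ : ∀ u v → adj J (u ↑ˡ n₁) (v ↑ˡ n₁) ≡ adj G₀ u v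
  adj-join-ˡˡ u v rewrite splitAt-↑ˡ n₀ u n₁ | splitAt-↑ˡ n₀ v n₁ = refl

  adj-join-ʳʳ : ∀ u v → adj J (n₀ ↑ʳ u) (n₀ ↑ʳ v) ≡ adj G₁ u v
  adj-join-ʳʳ u v rewrite splitAt-↑ʳ n₀ n₁ u | splitAt-↑ʳ n₀ n₁ v = refl

  adj-join-ˡʳ : ∀ u v → adj J (u ↑ˡ n₁) (n₀ ↑ʳ v) ≡ does (to u ≟ v)
  adj-join-ˡʳ u v rewrite splitAt-↑ˡ n₀ u n₁ | splitAt-↑ʳ n₀ n₁ v = refl

  adj-join-ʳˡ : ∀ v u → adj J (n₀ ↑ʳ v) (u ↑ˡ n₁) ≡ does (to u ≟ v)
  adj-join-ʳˡ v u rewrite splitAt-↑ʳ n₀ n₁ v | splitAt-↑ˡ n₀ u n₁ = refl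

  Undirected-join : Undirected G₀ → Undirected G₁ → Undirected J
  Undirected-join undirected₀ undirected₁ x y with splitAt n₀ x | splitAt n₀ y
  ... | inj₁ u | inj₁ v = undirected₀ u v
  ... | inj₂ u | inj₂ v = undirected₁ u v
  ... | inj₁ u | inj₂ v = refl
  ... | inj₂ u | inj₁ v = refl

  restrictˡ : Subset (n₀ + n₁) → Subset n₀
  restrictˡ Y = tabulate (λ u → lookup Y (u ↑ˡ n₁))

  restrictʳ : Subset (n₀ + n₁) → Subset n₁
  restrictʳ Y = tabulate (λ v → lookup Y (n₀ ↑ʳ v))

  ∣∣-join : ∀ Y → ∣ Y ∣ ≡ ∣ restrictˡ Y ∣ + ∣ restrictʳ Y ∣
  ∣∣-join Y = begin
    ∣ Y ∣                                                                   ≡⟨ ∣∣≡∑ Y ⟩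
    ∑[ x < n₀ + n₁ ] indicator (lookup Y x)                                 ≡⟨ ∑-↑ n₀ n₁ _ ⟩
    ∑[ u < n₀ ] indicator (lookup Y (u ↑ˡ n₁)) + ∑[ v < n₁ ] indicator (lookup Y (n₀ ↑ʳ v))
      ≡⟨ sym (cong₂ _+_ (∣tabulate∣ (λ u → lookup Y (u ↑ˡ n₁))) (∣tabulate∣ (λ v → lookup Y (n₀ ↑ʳ v)))) ⟩
    ∣ restrictˡ Y ∣ + ∣ restrictʳ Y ∣                                       ∎
    where open ≡-Reasoning

  arcsIn-join : ∀ Y → let Y₀ = restrictˡ Y; Y₁ = restrictʳ Y in
                arcsIn J Y ≡ (arcsIn G₀ Y₀ + matchedIn π Y₀ Y₁) + (matchedIn π Y₀ Y₁ + arcsIn G₁ Y₁)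
  arcsIn-join Y = trans (∑∑-↑ n₀ n₁ arc) (cong₂ _+_ (cong₂ _+_ inside₀ crossing₀₁) (cong₂ _+_ crossing₁₀ inside₁))
    where
    Y₀ = restrictˡ Y
    Y₁ = restrictʳ Y
    arc : Fin (n₀ + n₁) → Fin (n₀ + n₁) → ℕ
    arc x y = indicator (lookup Y x ∧ lookup Y y ∧ adj J x y)
    in₀ : ∀ u → lookup Y (u ↑ˡ n₁) ≡ lookup Y₀ u
    in₀ u = sym (lookup∘tabulate _ u)
    in₁ : ∀ v → lookup Y (n₀ ↑ʳ v) ≡ lookup Y₁ v
    in₁ v = sym (lookup∘tabulate _ v)
    inside₀ : ∑[ u < n₀ ] ∑[ u′ < n₀ ] arc (u ↑ˡ n₁) (u′ ↑ˡ n₁) ≡ arcsIn G₀ Y₀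
    inside₀ = sum-cong-≗ (λ u → sum-cong-≗ (λ u′ → indicator-∧₃-cong (in₀ u) (in₀ u′) (adj-join-ˡˡ u u′)))
    inside₁ : ∑[ v < n₁ ] ∑[ v′ < n₁ ] arc (n₀ ↑ʳ v) (n₀ ↑ʳ v′) ≡ arcsIn G₁ Y₁
    inside₁ = sum-cong-≗ (λ v → sum-cong-≗ (λ v′ → indicator-∧₃-cong (in₁ v) (in₁ v′) (adj-join-ʳʳ v v′)))
    crossing₀₁ : ∑[ u < n₀ ] ∑[ v < n₁ ] arc (u ↑ˡ n₁) (n₀ ↑ʳ v) ≡ matchedIn π Y₀ Y₁
    crossing₀₁ = trans (sum-cong-≗ (λ u → sum-cong-≗ (λ v → indicator-∧₃-cong (in₀ u) (in₁ v) (adj-join-ˡʳ u v))))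
                       (∑∑≡matchedIn π Y₀ Y₁)
    crossing₁₀ : ∑[ v < n₁ ] ∑[ u < n₀ ] arc (n₀ ↑ʳ v) (u ↑ˡ n₁) ≡ matchedIn π Y₀ Y₁
    crossing₁₀ = begin
      ∑[ v < n₁ ] ∑[ u < n₀ ] arc (n₀ ↑ʳ v) (u ↑ˡ n₁)    ≡⟨ sym (∑-comm (λ u v → arc (n₀ ↑ʳ v) (u ↑ˡ n₁))) ⟩
      ∑[ u < n₀ ] ∑[ v < n₁ ] arc (n₀ ↑ʳ v) (u ↑ˡ n₁)
        ≡⟨ sum-cong-≗ (λ u → sum-cong-≗ (λ v → trans (indicator-∧₃-cong (in₁ v) (in₀ u) (adj-join-ʳˡ v u))
                                                       (cong indicator (∧-exchange (lookup Y₁ v) (lookup Y₀ u) _)))) ⟩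
      ∑[ u < n₀ ] ∑[ v < n₁ ] indicator (lookup Y₀ u ∧ lookup Y₁ v ∧ does (to u ≟ v))
        ≡⟨ ∑∑≡matchedIn π Y₀ Y₁ ⟩
      matchedIn π Y₀ Y₁                                   ∎
      where open ≡-Reasoning

  ArcBound-join : ∀ {F} → (∀ a b → MinSuperadditive F a b) → ArcBound F G₀ → ArcBound F G₁ → ArcBound F J
  ArcBound-join {F} F-superadditive bound₀ bound₁ Y = begin
    arcsIn J Y                                     ≡⟨ arcsIn-join Y ⟩
    (arcsIn G₀ Y₀ + M) + (M + arcsIn G₁ Y₁)        ≤⟨ +-mono-≤ (+-mono-≤ (bound₀ Y₀) M≤) (+-mono-≤ M≤ (bound₁ Y₁)) ⟩
    (F ∣ Y₀ ∣ + m) + (m + F ∣ Y₁ ∣)                ≡⟨ solve 3 (λ x y m → (x :+ m) :+ (m :+ y) := x :+ y :+ con 2 :* m)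
                                                             refl (F ∣ Y₀ ∣) (F ∣ Y₁ ∣) m ⟩
    F ∣ Y₀ ∣ + F ∣ Y₁ ∣ + 2 * m                    ≤⟨ F-superadditive ∣ Y₀ ∣ ∣ Y₁ ∣ ⟩
    F (∣ Y₀ ∣ + ∣ Y₁ ∣)                            ≡⟨ cong F (sym (∣∣-join Y)) ⟩
    F ∣ Y ∣                                        ∎
    where
    open ≤-Reasoning
    Y₀ = restrictˡ Y
    Y₁ = restrictʳ Y
    M  = matchedIn π Y₀ Y₁
    m  = ∣ Y₀ ∣ ⊓ ∣ Y₁ ∣
    M≤ : M ≤ m
    M≤ = matchedIn≤⊓ π Y₀ Y₁

K4-undirected : Undirected K4
K4-undirected u v with u ≟ v | v ≟ u
... | yes _   | yes _   = refl
... | no _    | no _    = refl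
... | yes u≡v | no v≢u  = ⊥-elim (v≢u (sym u≡v))
... | no u≢v  | yes v≡u = ⊥-elim (u≢v (sym v≡u))

K4-arcBound : ArcBound f K4
K4-arcBound (true  ∷ true  ∷ true  ∷ true  ∷ []) = ≤ᵇ⇒≤ _ _ _
K4-arcBound (true  ∷ true  ∷ true  ∷ false ∷ []) = ≤ᵇ⇒≤ _ _ _
K4-arcBound (true  ∷ true  ∷ false ∷ true  ∷ []) = ≤ᵇ⇒≤ _ _ _
K4-arcBound (true  ∷ true  ∷ false ∷ false ∷ []) = ≤ᵇ⇒≤ _ _ _
K4-arcBound (true  ∷ false ∷ true  ∷ true  ∷ []) = ≤ᵇ⇒≤ _ _ _
K4-arcBound (true  ∷ false ∷ true  ∷ false ∷ []) = ≤ᵇ⇒≤ _ _ _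
K4-arcBound (true  ∷ false ∷ false ∷ true  ∷ []) = ≤ᵇ⇒≤ _ _ _
K4-arcBound (true  ∷ false ∷ false ∷ false ∷ []) = ≤ᵇ⇒≤ _ _ _
K4-arcBound (false ∷ true  ∷ true  ∷ true  ∷ []) = ≤ᵇ⇒≤ _ _ _
K4-arcBound (false ∷ true  ∷ true  ∷ false ∷ []) = ≤ᵇ⇒≤ _ _ _
K4-arcBound (false ∷ true  ∷ false ∷ true  ∷ []) = ≤ᵇ⇒≤ _ _ _
K4-arcBound (false ∷ true  ∷ false ∷ false ∷ []) = ≤ᵇ⇒≤ _ _ _
K4-arcBound (false ∷ false ∷ true  ∷ true  ∷ []) = ≤ᵇ⇒≤ _ _ _
K4-arcBound (false ∷ false ∷ true  ∷ false ∷ []) = ≤ᵇ⇒≤ _ _ _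
K4-arcBound (false ∷ false ∷ false ∷ true  ∷ []) = ≤ᵇ⇒≤ _ _ _
K4-arcBound (false ∷ false ∷ false ∷ false ∷ []) = ≤ᵇ⇒≤ _ _ _

ℋ⇒undirected : ∀ {n G} → ℋ n G → Undirected G
ℋ⇒undirected (base G≅K4)                              = Undirected-≅ G≅K4 K4-undirected
ℋ⇒undirected (step {G0 = G₀} {G₁} π G₀∈ℋ G₁∈ℋ G≅join) =
  Undirected-≅ G≅join (Undirected-join G₀ G₁ π (ℋ⇒undirected G₀∈ℋ) (ℋ⇒undirected G₁∈ℋ))

ℋ⇒arcBound : ∀ {n G} → ℋ n G → ArcBound f G
ℋ⇒arcBound (base G≅K4)                              = ArcBound-≅ G≅K4 {f} K4-arcBound
ℋ⇒arcBound (step {G0 = G₀} {G₁} π G₀∈ℋ G₁∈ℋ G≅join) =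
  ArcBound-≅ G≅join {f} (ArcBound-join G₀ G₁ π {f} f-superadditive (ℋ⇒arcBound G₀∈ℋ) (ℋ⇒arcBound G₁∈ℋ))

ex≤ : ∀ G m {B} → (∀ X → ∣ X ∣ ≡ m → 2 * edgesIn G X ≤ B) → ex m G ≤ B
ex≤ G m {B} bound = go (allSubsets (size G))
  where
  go : ∀ Xs → foldr _⊔_ 0 (map (λ X → 2 * edgesIn G X) (filter (λ X → ∣ X ∣ Data.Nat.≟ m) Xs)) ≤ B
  go []       = z≤n
  go (X ∷ Xs) with ∣ X ∣ ≡ᵇ m in ∣X∣≡ᵇm
  ... | true  = ⊔-lub (bound X (≡ᵇ⇒≡ ∣ X ∣ m (subst T (sym ∣X∣≡ᵇm) _))) (go Xs)
  ... | false = go Xs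

-- The bound holds for every m and every n.
lemma3p1 : (n : ℕ) → 2 ≤ n → (G : Graph) → ℋ n G →
    (m : ℕ) → 1 ≤ m → m ≤ 2 ^ n → ex m G ≤ f m
lemma3p1 n _ G G∈ℋ m _ _ = ex≤ G m λ X ∣X∣≡m → begin
  2 * edgesIn G X  ≤⟨ 2*edgesIn≤arcsIn G (ℋ⇒undirected G∈ℋ) X ⟩
  arcsIn G X       ≤⟨ ℋ⇒arcBound G∈ℋ X ⟩
  f ∣ X ∣          ≡⟨ cong f ∣X∣≡m ⟩
  f m              ∎
  where open ≤-Reasoning
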